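{- Let $Rel$ be the Seely category described in the context. For sets $X, A$ and a relation $f \subseteq (\mathcal{M}_{fin}(X)\times \mathcal{M}_{fin}(A)) \times A$ (i.e. a morphism $f : {!X}\otimes{!A}\to A$ of $Rel$), define $$Y_{X,A}(f) = \{(w,a) \in \mathcal{M}_{fin}(X)\times A \mid \exists\, \textit{witness} \in \mathrm{RunTree}(f,a) \text{ finite, with } w = \mathrm{leaves}(\textit{witness})\} \ :\ {!X}\to A,$$ where run-trees and $\mathrm{leaves}$ are as defined in the context. Then the family $(Y_{X,A})_{X,A}$ is a Conway operator on $Rel$.
   Context: The category $Rel$ has finite or countable sets as objects and binary relations $f\subseteq A\times B$ as morphisms $A\to B$, with composition $g\circ f=\{(a,c)\mid \exists b,\ (a,b)\in f,\ (b,c)\in g\}$. Tensor: $A\otimes B=A\times B$, $f\otimes g=\{((a,c),(b,d))\mid (a,b)\in f,(c,d)\in g\}$, unit $1=\{\star\}$. Product: $A\& B=\{(1,a)\mid a\in A\}\cup\{(2,b)\mid b\in B\}$, terminal object $\top=\emptyset$, diagonal $\Delta_A=\{(a,(i,a))\mid i\in\{1,2\}, a\in A\}: A\to A\&A$. Exponential: $!A=\mathcal{M}_{fin}(A)$ is the set of finite multisets over $A$ (functions $A\to\mathbb{N}$ of finite support), written $[a_1,\dots,a_n]$; $!f=\{([a_1,\dots,a_n],[b_1,\dots,b_n])\mid \forall i,(a_i,b_i)\in f\}$; $\mathrm{dig}_A=\{(w_1+\dots+w_k,[w_1,\dots,w_k])\mid w_i\in !A\}: !A\to !!A$; $\mathrm{der}_A=\{([a],a)\mid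 a\in A\}: !A\to A$; $m^0=\{(\star,[])\}:1\to !\top$; $m_{A,B}: !A\otimes !B\to !(A\&B)$ relates $([a_1,\dots,a_m],[b_1,\dots,b_n])$ to $[(1,a_1),\dots,(1,a_m),(2,b_1),\dots,(2,b_n)]$. This is a Seely category (a model of linear logic). Conway operator. Let $\mathscr{C}$ be a Seely category: a symmetric monoidal closed category $(\mathscr{C},\otimes,1)$ with finite products $(\&,\top)$, a comonad $(!,\mathrm{dig},\mathrm{der})$ ($\mathrm{dig}_A:!A\to !!A$, $\mathrm{der}_A:!A\to A$), and natural isomorphisms $m_{A,B}:!A\otimes !B\to !(A\&B)$, $m^0:1\to !\top$ satisfying the Seely coherence conditions. Write $\Delta_X:X\to X\&X$ for the diagonal and $c_X=m_{X,X}^{ -1}\circ !\Delta_X: !X\to !X\otimes !X$ (associativity isomorphisms of $\otimes$ are left implicit). A Conway operator on $\mathscr{C}$ is a family of functions $Y_{X,A}:\mathscr{C}(!X\otimes !A,A)\to\mathscr{C}(!X,A)$ such that: (1) Naturality: for all $g:!X\to Z$ and $f:!Z\otimes !A\to A$, $Y_{X,A}(f\circ((!g\circ \mathrm{dig}_X)\otimes \mathrm{id}_{!A}))=Y_{Z,A}(f)\circ !g\circ\mathrm{dig}_X$. (2) Parametrized fixpoint: for all $f:!X\otimes !A\to A$, $Y_{X,A}(f)=f\circ(\mathrm{id}_{!X}\otimes(!Y_{X,A}(f)\circ\mathrm{dig}_X))\circ c_X$. (3) Parametrized dinaturality: for $f:!X\otimes !B\to A$ and $g:!X\otimes !A\to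 B$ define $f\star g: !X\otimes !A\to A$ as $f\star g=f\circ(\mathrm{id}_{!X}\otimes !(g\circ m_{X,A}^{ -1}))\circ(\mathrm{id}_{!X}\otimes\mathrm{dig}_{X\&A})\circ(\mathrm{id}_{!X}\otimes m_{X,A})\circ(c_X\otimes\mathrm{id}_{!A})$. Then $Y_{X,A}(f\star g)=f\circ(\mathrm{id}_{!X}\otimes(!Y_{X,B}(g\star f)\circ\mathrm{dig}_X))\circ c_X$. (4) Diagonal property: for every $f:!X\otimes !A\otimes !A\to A$, $Y_{X,A}\big(Y_{X\&A,A}(f\circ(m_{X,A}^{ -1}\otimes\mathrm{id}_{!A}))\circ m_{X,A}\big)=Y_{X,A}\big(f\circ(\mathrm{id}_{!X}\otimes(m_{A,A}^{ -1}\circ !\Delta_A))\big)$. Run-trees. Given $f:!X\otimes !A\to A$ in $Rel$ and $a\in A$, $\mathrm{RunTree}(f,a)$ is the set of rooted trees (each node with finitely many children) whose nodes are labelled by elements of $X\uplus A$, such that: the root is labelled $a$; every node labelled by an element of $X$ is a leaf; and for every node labelled by $b\in A$, if $[x_1,\dots,x_m]$ is the multiset of labels in $X$ of its children and $[a_1,\dots,a_n]$ the multiset of labels in $A$ of its children, then $(([x_1,\dots,x_m],[a_1,\dots,a_n]),b)\in f$ (in particular a leaf labelled $b\in A$ requires $(([],[]),b)\in f$). $\mathrm{leaves}(\textit{witness})$ is the multiset of labels of the $X$-labelled leaves of $\textit{witness}$ (counted with multiplicity). -}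

module Defs where

-- The category Rel, presented over setoids: an object is a setoid (a set
-- presented as a carrier modulo an equivalence; the finite multisets !A are
-- lists modulo permutation), a morphism A → B is a relation on carriers
-- (we require it to respect the equivalences where it is a hypothesis), and
-- two morphisms are equal when the relations contain each other.

open import Level using (0ℓ)
open import Data.Nat using (ℕ)
open import Data.Product using (Σ; ∃; _×_; _,_)
open import Data.Sum using (_⊎_; inj₁; inj₂)
open import Data.List using (List; []; _∷_; _++_; map; concat)
open import Data.List.Relation.Binary.Pointwise using (Pointwise)
open import Relation.Binary.Bundles using (Setoid)
open import Relation.Binary.PropositionalEquality using (_≡_)
open import Data.Product.Relation.Binary.Pointwise.NonDependent using (×-setoid)
open import Data.Sum.Relation.Binary.Pointwise using (⊎-setoid)
import Data.List.Relation.Binary.Permutation.Setoid as Perm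

Obj : Set₁
Obj = Setoid 0ℓ 0ℓ

∣_∣ : Obj → Set
∣ A ∣ = Setoid.Carrier A

-- Objects of Rel are finite or countable sets: there is an injection of the
-- quotient into ℕ (a code respecting and reflecting the equivalence).
Countable : Obj → Set
Countable A = Σ (∣ A ∣ → ℕ) λ code →
  ((x y : ∣ A ∣) → Setoid._≈_ A x y → code x ≡ code y) ×
  ((x y : ∣ A ∣) → code x ≡ code y → Setoid._≈_ A x y)

_⊗_ : Obj → Obj → Obj
A ⊗ B = ×-setoid A B

-- Product A & B = {1} × A ∪ {2} × B  (inj₁ = tag 1, inj₂ = tag 2)
_&_ : Obj → Obj → Obj
A & B = ⊎-setoid A B

!_ : Obj → Obj
! A = Perm.↭-setoid A

infixr 6 _⊗_
infixr 7 _&_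
infix 8 !_

_≈!_ : {A : Obj} → List ∣ A ∣ → List ∣ A ∣ → Set
_≈!_ {A} u v = Perm._↭_ A u v

record Hom (A B : Obj) : Set₁ where
  constructor rel
  field
    _∋_ : ∣ A ∣ → ∣ B ∣ → Set

_∈R_ : {A B : Obj} → ∣ A ∣ × ∣ B ∣ → Hom A B → Set
(a , b) ∈R R = Hom._∋_ R a b

infix 4 _∈R_

Respects : (A B : Obj) → Hom A B → Set
Respects A B R = ∀ a a' b b' → Setoid._≈_ A a a' → Setoid._≈_ B b b' →
  (a , b) ∈R R → (a' , b') ∈R R

_≐_ : {A B : Obj} → Hom A B → Hom A B → Set
_≐_ {A} {B} R S = (∀ a b → (a , b) ∈R R → (a , b) ∈R S) ×
                  (∀ a b → (a , b) ∈R S → (a , b) ∈R R)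

infix 4 _≐_

idR : (A : Obj) → Hom A A
idR A = rel λ a a' → Setoid._≈_ A a a'

_∘R_ : {A B C : Obj} → Hom B C → Hom A B → Hom A C
_∘R_ {A} {B} {C} g f = rel λ a x → ∃ λ (b : ∣ B ∣) → (a , b) ∈R f × (b , x) ∈R g

infixr 9 _∘R_

_⊗R_ : {A B C D : Obj} → Hom A B → Hom C D → Hom (A ⊗ C) (B ⊗ D)
_⊗R_ f g = rel λ { (a , x) (b , d) → (a , b) ∈R f × (x , d) ∈R g }

infixr 10 _⊗R_

-- converse (the inverse of an isomorphism of Rel)
conv : {A B : Obj} → Hom A B → Hom B A
conv R = rel λ b a → (a , b) ∈R R

!R : {A B : Obj} → Hom A B → Hom (! A) (! B)
!R {A} {B} f = rel λ u v →
  ∃ λ (v' : List ∣ B ∣) → Pointwise (Hom._∋_ f) u v' × _≈!_ {B} v' v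

dig : (A : Obj) → Hom (! A) (! ! A)
dig A = rel λ w W →
  ∃ λ (ws : List (List ∣ A ∣)) → _≈!_ { ! A} W ws × _≈!_ {A} w (concat ws)

der : (A : Obj) → Hom (! A) A
der A = rel λ w a → _≈!_ {A} w (a ∷ [])

m : (A B : Obj) → Hom (! A ⊗ ! B) (! (A & B))
m A B = rel λ { (u , v) w → _≈!_ {A & B} w (map inj₁ u ++ map inj₂ v) }

m⁻¹ : (A B : Obj) → Hom (! (A & B)) (! A ⊗ ! B)
m⁻¹ A B = conv (m A B)

Δ : (A : Obj) → Hom A (A & A)
Δ A = rel λ { a (inj₁ a') → Setoid._≈_ A a a' ; a (inj₂ a') → Setoid._≈_ A a a' }

c : (X : Obj) → Hom (! X) (! X ⊗ ! X)
c X = m⁻¹ X X ∘R !R (Δ X)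

α : (A B C : Obj) → Hom ((A ⊗ B) ⊗ C) (A ⊗ (B ⊗ C))
α A B C = rel λ { ((a , b) , x) (a' , (b' , x')) →
  Setoid._≈_ A a a' × Setoid._≈_ B b b' × Setoid._≈_ C x x' }

α⁻¹ : (A B C : Obj) → Hom (A ⊗ (B ⊗ C)) ((A ⊗ B) ⊗ C)
α⁻¹ A B C = conv (α A B C)

module RunTrees (X A : Obj) (f : Hom (! X ⊗ ! A) A) where

  -- A node labelled b has X-labelled
  -- children (leaves) xs and A-labelled children which are the roots of
  -- the trees of a forest, with root labels as; we need (([xs],[as]), b) ∈ f.
  data RunTree : ∣ A ∣ → List ∣ X ∣ → Set
  data Forest : List ∣ A ∣ → List (List ∣ X ∣) → Set

  data RunTree where
    node : (b : ∣ A ∣) (xs : List ∣ X ∣) (as : List ∣ A ∣) (ws : List (List ∣ X ∣)) →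
           Forest as ws → ((xs , as) , b) ∈R f → RunTree b (xs ++ concat ws)

  data Forest where
    []  : Forest [] []
    _∷_ : {a : ∣ A ∣} {w : List ∣ X ∣} {as : List ∣ A ∣} {ws : List (List ∣ X ∣)} →
          RunTree a w → Forest as ws → Forest (a ∷ as) (w ∷ ws)

Y : (X A : Obj) → Hom (! X ⊗ ! A) A → Hom (! X) A
Y X A f = rel λ w a →
  ∃ λ (w' : List ∣ X ∣) → RunTrees.RunTree X A f a w' × _≈!_ {X} w' w

star : (X A B : Obj) → Hom (! X ⊗ ! B) A → Hom (! X ⊗ ! A) B → Hom (! X ⊗ ! A) A
star X A B f g =
  f ∘R (idR (! X) ⊗R !R (g ∘R m⁻¹ X A))
    ∘R (idR (! X) ⊗R dig (X & A))
    ∘R (idR (! X) ⊗R m X A)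
    ∘R α (! X) (! X) (! A)
    ∘R (c X ⊗R idR (! A))

record IsConway (Yop : (X A : Obj) → Hom (! X ⊗ ! A) A → Hom (! X) A) : Set₁ where
  field
    naturality : (X Z A : Obj) → Countable X → Countable Z → Countable A →
      (g : Hom (! X) Z) (f : Hom (! Z ⊗ ! A) A) →
      Respects (! X) Z g → Respects (! Z ⊗ ! A) A f →
      Yop X A (f ∘R ((!R g ∘R dig X) ⊗R idR (! A)))
        ≐ Yop Z A f ∘R !R g ∘R dig X
    fixpoint : (X A : Obj) → Countable X → Countable A →
      (f : Hom (! X ⊗ ! A) A) → Respects (! X ⊗ ! A) A f →
      Yop X A f ≐ f ∘R (idR (! X) ⊗R (!R (Yop X A f) ∘R dig X)) ∘R c X
    dinaturality : (X A B : Obj) → Countable X → Countable A → Countable B →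
      (f : Hom (! X ⊗ ! B) A) (g : Hom (! X ⊗ ! A) B) →
      Respects (! X ⊗ ! B) A f → Respects (! X ⊗ ! A) B g →
      Yop X A (star X A B f g)
        ≐ f ∘R (idR (! X) ⊗R (!R (Yop X B (star X B A g f)) ∘R dig X)) ∘R c X
    diagonal : (X A : Obj) → Countable X → Countable A →
      (f : Hom ((! X ⊗ ! A) ⊗ ! A) A) → Respects ((! X ⊗ ! A) ⊗ ! A) A f →
      Yop X A (Yop (X & A) A (f ∘R (m⁻¹ X A ⊗R idR (! A))) ∘R m X A)
        ≐ Yop X A (f ∘R α⁻¹ (! X) (! A) (! A)
                     ∘R (idR (! X) ⊗R (m⁻¹ A A ∘R !R (Δ A))))

-- Y f relates w to a when some finite run tree of f with root a has w as its
-- multiset of X-leaves, so Y f is the least relation closed under the clauses of f,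
-- and is itself closed. Each axiom is an equality of relations, proved by an
-- induction on run trees in each direction once every composite of dig, c, m and !
-- occurring in it is unfolded into a flat description of one step. A run tree is a
-- root clause over a forest (fixpoint); the parameter multiset of an f-tree is the
-- image under g of a splitting of w (naturality); the layers of an (f ⋆ g)-tree
-- alternate between f- and g-clauses and regroup into (g ⋆ f)-trees below a single
-- f-clause (dinaturality); and a tree whose nodes are run trees with leaves in
-- X & A flattens into a single tree of f with its two A-arguments contracted, and
-- conversely (diagonal).

module Submission where

open import Defs
open import Level using (0ℓ)
open import Function using (id; flip)
open import Data.Product using (∃; ∃₂; _×_; _,_)
open import Data.Sum using (_⊎_; inj₁; inj₂)
open import Data.List using (List; []; _∷_; _++_; map; concat; [_])
open import Data.List.Relation.Binary.Pointwise as Pointwise using (Pointwise; []; _∷_)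
open import Data.List.Relation.Unary.All using (All; []; _∷_)
open import Relation.Binary.Core using (REL)
open import Relation.Binary.Definitions using (_Respectsʳ_; _Respectsˡ_)
open import Relation.Binary.Bundles using (Setoid)
open import Relation.Binary.PropositionalEquality using (_≡_; refl; sym; trans; cong; cong₂; subst₂)
open import Data.Sum.Relation.Binary.Pointwise using (inj₁; inj₂)
import Data.List.Relation.Binary.Permutation.Setoid as Permutation
import Data.List.Relation.Binary.Permutation.Setoid.Properties as PermutationProperties
import Data.List.Properties as List

-- Multisets

module Multiset (S : Obj) where
  open Setoid S public using (_≈_) renaming (refl to ≈-refl; sym to ≈-sym; trans to ≈-trans)
  open Permutation S public
  open PermutationProperties S public using (++⁺; ++⁺ˡ; ++⁺ʳ; ++-assoc; shifts; ↭-shift)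

  concat-↭ : ∀ {Ls Ms} → Permutation._↭_ (! S) Ls Ms → concat Ls ↭ concat Ms
  concat-↭ = PermutationProperties.foldr-commMonoid (! S) (PermutationProperties.++-isCommutativeMonoid S)

  concat-pointwise-↭ : ∀ {Ls Ms} → Pointwise _↭_ Ls Ms → concat Ls ↭ concat Ms
  concat-pointwise-↭ ps = concat-↭ (refl ps)

  ++-interchange : ∀ a b c d → (a ++ b) ++ (c ++ d) ↭ (a ++ c) ++ (b ++ d)
  ++-interchange a b c d = begin
    (a ++ b) ++ (c ++ d)  ↭⟨ ++-assoc a b (c ++ d) ⟩
    a ++ (b ++ c ++ d)    ↭⟨ ++⁺ˡ a (shifts b c) ⟩
    a ++ (c ++ b ++ d)    ↭⟨ ++-assoc a c (b ++ d) ⟨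
    (a ++ c) ++ (b ++ d)  ∎
    where open PermutationReasoning

module _ {A B : Set} {R : REL A B 0ℓ} where

  Pointwise-++⁻ʳ : ∀ ys zs {xs} → Pointwise R xs (ys ++ zs) →
    ∃₂ λ xs₁ xs₂ → xs ≡ xs₁ ++ xs₂ × Pointwise R xs₁ ys × Pointwise R xs₂ zs
  Pointwise-++⁻ʳ [] zs rs = [] , _ , refl , [] , rs
  Pointwise-++⁻ʳ (y ∷ ys) zs (r ∷ rs) with Pointwise-++⁻ʳ ys zs rs
  ... | xs₁ , xs₂ , refl , rs₁ , rs₂ = _ ∷ xs₁ , xs₂ , refl , r ∷ rs₁ , rs₂

  Pointwise-concat⁻ʳ : ∀ zss {xs} → Pointwise R xs (concat zss) →
    ∃ λ xss → xs ≡ concat xss × Pointwise (Pointwise R) xss zss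
  Pointwise-concat⁻ʳ [] [] = [] , refl , []
  Pointwise-concat⁻ʳ (zs ∷ zss) rs with Pointwise-++⁻ʳ zs (concat zss) rs
  ... | xs₁ , xs₂ , refl , rs₁ , rs₂ with Pointwise-concat⁻ʳ zss rs₂
  ... | xss , refl , rss = xs₁ ∷ xss , refl , rs₁ ∷ rss

module _ {A B : Set} {R : REL A B 0ℓ} where

  Pointwise-++⁻ˡ : ∀ xs ys {zs} → Pointwise R (xs ++ ys) zs →
    ∃₂ λ zs₁ zs₂ → zs ≡ zs₁ ++ zs₂ × Pointwise R xs zs₁ × Pointwise R ys zs₂
  Pointwise-++⁻ˡ xs ys rs with Pointwise-++⁻ʳ xs ys (Pointwise.symmetric id rs)
  ... | zs₁ , zs₂ , eq , rs₁ , rs₂ =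
    zs₁ , zs₂ , eq , Pointwise.symmetric id rs₁ , Pointwise.symmetric id rs₂

  Pointwise-concat⁻ˡ : ∀ xss {zs} → Pointwise R (concat xss) zs →
    ∃ λ zss → zs ≡ concat zss × Pointwise (Pointwise R) xss zss
  Pointwise-concat⁻ˡ xss rs with Pointwise-concat⁻ʳ xss (Pointwise.symmetric id rs)
  ... | zss , eq , rss = zss , eq , Pointwise.symmetric (Pointwise.symmetric id) rss

module _ (A B : Obj) {R : REL ∣ A ∣ ∣ B ∣ 0ℓ} where
  private
    module MA = Multiset A
    module MB = Multiset B

  Pointwise-↭ʳ : R Respectsʳ Setoid._≈_ B → ∀ {us vs vs'} → Pointwise R us vs → vs MB.↭ vs' →
    ∃ λ us' → us MA.↭ us' × Pointwise R us' vs'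
  Pointwise-↭ʳ resp {us} rs (MB.refl es) = us , MA.↭-refl , Pointwise.respʳ resp es rs
  Pointwise-↭ʳ resp (r ∷ rs) (MB.prep e p) with Pointwise-↭ʳ resp rs p
  ... | _ , q , rs' = _ , MA.prep MA.≈-refl q , resp e r ∷ rs'
  Pointwise-↭ʳ resp (r₁ ∷ r₂ ∷ rs) (MB.swap e₁ e₂ p) with Pointwise-↭ʳ resp rs p
  ... | _ , q , rs' = _ , MA.swap MA.≈-refl MA.≈-refl q , resp e₂ r₂ ∷ resp e₁ r₁ ∷ rs'
  Pointwise-↭ʳ resp rs (MB.trans p p') with Pointwise-↭ʳ resp rs p
  ... | _ , q , rs' with Pointwise-↭ʳ resp rs' p'
  ... | us'' , q' , rs'' = us'' , MA.↭-trans q q' , rs''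

module _ (A B : Obj) {R : REL ∣ A ∣ ∣ B ∣ 0ℓ} where
  private
    module MA = Multiset A
    module MB = Multiset B

  Pointwise-↭ˡ : R Respectsˡ Setoid._≈_ A → ∀ {us us' vs} → Pointwise R us vs → us MA.↭ us' →
    ∃ λ vs' → vs MB.↭ vs' × Pointwise R us' vs'
  Pointwise-↭ˡ resp rs p with Pointwise-↭ʳ B A {flip R} resp (Pointwise.symmetric id rs) p
  ... | vs' , q , rs' = vs' , q , Pointwise.symmetric id rs'


module Tagged (A B : Obj) where
  private
    module MA = Multiset A
    module MB = Multiset B
    module MAB = Multiset (A & B)

  tagged : List ∣ A ∣ → List ∣ B ∣ → List (∣ A ∣ ⊎ ∣ B ∣)
  tagged u v = map inj₁ u ++ map inj₂ v

  lefts : List (∣ A ∣ ⊎ ∣ B ∣) → List ∣ A ∣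
  lefts [] = []
  lefts (inj₁ a ∷ L) = a ∷ lefts L
  lefts (inj₂ b ∷ L) = lefts L

  rights : List (∣ A ∣ ⊎ ∣ B ∣) → List ∣ B ∣
  rights [] = []
  rights (inj₁ a ∷ L) = rights L
  rights (inj₂ b ∷ L) = b ∷ rights L

  lefts-tagged : ∀ u v → lefts (tagged u v) ≡ u
  lefts-tagged (a ∷ u) v = cong (a ∷_) (lefts-tagged u v)
  lefts-tagged [] [] = refl
  lefts-tagged [] (b ∷ v) = lefts-tagged [] v

  rights-tagged : ∀ u v → rights (tagged u v) ≡ v
  rights-tagged (a ∷ u) v = rights-tagged u v
  rights-tagged [] [] = refl
  rights-tagged [] (b ∷ v) = cong (b ∷_) (rights-tagged [] v)

  lefts-↭ : ∀ {L L'} → L MAB.↭ L' → lefts L MA.↭ lefts L'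
  lefts-↭ (MAB.refl []) = MA.↭-refl
  lefts-↭ (MAB.refl (inj₁ e ∷ es)) = MA.prep e (lefts-↭ (MAB.refl es))
  lefts-↭ (MAB.refl (inj₂ e ∷ es)) = lefts-↭ (MAB.refl es)
  lefts-↭ (MAB.prep (inj₁ e) p) = MA.prep e (lefts-↭ p)
  lefts-↭ (MAB.prep (inj₂ e) p) = lefts-↭ p
  lefts-↭ (MAB.swap (inj₁ e₁) (inj₁ e₂) p) = MA.swap e₁ e₂ (lefts-↭ p)
  lefts-↭ (MAB.swap (inj₁ e₁) (inj₂ e₂) p) = MA.prep e₁ (lefts-↭ p)
  lefts-↭ (MAB.swap (inj₂ e₁) (inj₁ e₂) p) = MA.prep e₂ (lefts-↭ p)
  lefts-↭ (MAB.swap (inj₂ e₁) (inj₂ e₂) p) = lefts-↭ p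
  lefts-↭ (MAB.trans p q) = MA.↭-trans (lefts-↭ p) (lefts-↭ q)

  rights-↭ : ∀ {L L'} → L MAB.↭ L' → rights L MB.↭ rights L'
  rights-↭ (MAB.refl []) = MB.↭-refl
  rights-↭ (MAB.refl (inj₁ e ∷ es)) = rights-↭ (MAB.refl es)
  rights-↭ (MAB.refl (inj₂ e ∷ es)) = MB.prep e (rights-↭ (MAB.refl es))
  rights-↭ (MAB.prep (inj₁ e) p) = rights-↭ p
  rights-↭ (MAB.prep (inj₂ e) p) = MB.prep e (rights-↭ p)
  rights-↭ (MAB.swap (inj₁ e₁) (inj₁ e₂) p) = rights-↭ p
  rights-↭ (MAB.swap (inj₁ e₁) (inj₂ e₂) p) = MB.prep e₂ (rights-↭ p)
  rights-↭ (MAB.swap (inj₂ e₁) (inj₁ e₂) p) = MB.prep e₁ (rights-↭ p)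
  rights-↭ (MAB.swap (inj₂ e₁) (inj₂ e₂) p) = MB.swap e₁ e₂ (rights-↭ p)
  rights-↭ (MAB.trans p q) = MB.↭-trans (rights-↭ p) (rights-↭ q)

  tagged-cancel : ∀ {u v u' v'} → tagged u v MAB.↭ tagged u' v' → u MA.↭ u' × v MB.↭ v'
  tagged-cancel {u} {v} {u'} {v'} p =
    subst₂ MA._↭_ (lefts-tagged u v) (lefts-tagged u' v') (lefts-↭ p) ,
    subst₂ MB._↭_ (rights-tagged u v) (rights-tagged u' v') (rights-↭ p)

  ↭-tagged : ∀ L → L MAB.↭ tagged (lefts L) (rights L)
  ↭-tagged [] = MAB.↭-refl
  ↭-tagged (inj₁ a ∷ L) = MAB.prep (inj₁ MA.≈-refl) (↭-tagged L)
  ↭-tagged (inj₂ b ∷ L) = MAB.↭-trans (MAB.prep (inj₂ MB.≈-refl) (↭-tagged L))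
    (MAB.↭-sym (MAB.↭-shift (map inj₁ (lefts L)) (map inj₂ (rights L))))

  tagged⁺ : ∀ {u u' v v'} → u MA.↭ u' → v MB.↭ v' → tagged u v MAB.↭ tagged u' v'
  tagged⁺ p q = MAB.++⁺ (PermutationProperties.map⁺ A (A & B) inj₁ p)
                        (PermutationProperties.map⁺ B (A & B) inj₂ q)

  tagged-++ : ∀ u₁ v₁ u₂ v₂ → tagged u₁ v₁ ++ tagged u₂ v₂ MAB.↭ tagged (u₁ ++ u₂) (v₁ ++ v₂)
  tagged-++ u₁ v₁ u₂ v₂ =
    MAB.↭-trans (MAB.++-interchange (map inj₁ u₁) (map inj₂ v₁) (map inj₁ u₂) (map inj₂ v₂))
    (MAB.↭-reflexive (cong₂ _++_ (sym (List.map-++ inj₁ u₁ u₂)) (sym (List.map-++ inj₂ v₁ v₂))))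

module Contraction (X : Obj) where
  private
    module MX = Multiset X
    module MXX = Multiset (X & X)
  open Tagged X X using (tagged)

  untag : ∣ X ∣ ⊎ ∣ X ∣ → ∣ X ∣
  untag (inj₁ x) = x
  untag (inj₂ x) = x

  untag-tagged : ∀ u v → map untag (tagged u v) ≡ u ++ v
  untag-tagged (x ∷ u) v = cong (x ∷_) (untag-tagged u v)
  untag-tagged [] [] = refl
  untag-tagged [] (y ∷ v) = cong (y ∷_) (untag-tagged [] v)

  private
    _∈Δ_ : ∣ X ∣ → ∣ X ∣ ⊎ ∣ X ∣ → Set
    x ∈Δ z = Hom._∋_ (Δ X) x z

  Δ-respˡ : _∈Δ_ Respectsˡ MX._≈_
  Δ-respˡ {inj₁ _} e r = MX.≈-trans (MX.≈-sym e) r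
  Δ-respˡ {inj₂ _} e r = MX.≈-trans (MX.≈-sym e) r

  Δ-tagged : ∀ u v → Pointwise _∈Δ_ (u ++ v) (tagged u v)
  Δ-tagged (x ∷ u) v = MX.≈-refl ∷ Δ-tagged u v
  Δ-tagged [] [] = []
  Δ-tagged [] (y ∷ v) = MX.≈-refl ∷ Δ-tagged [] v

  Δ-untag : ∀ {w L} → Pointwise _∈Δ_ w L → Pointwise MX._≈_ w (map untag L)
  Δ-untag [] = []
  Δ-untag {L = inj₁ _ ∷ _} (r ∷ rs) = r ∷ Δ-untag rs
  Δ-untag {L = inj₂ _ ∷ _} (r ∷ rs) = r ∷ Δ-untag rs

  untag-cong : ∀ {z z'} → Setoid._≈_ (X & X) z z' → untag z MX.≈ untag z'
  untag-cong (inj₁ e) = e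
  untag-cong (inj₂ e) = e

  ∈c⁺ : ∀ {w} u v → w MX.↭ u ++ v → (w , (u , v)) ∈R c X
  ∈c⁺ u v p with Pointwise-↭ˡ X (X & X) (λ {z} → Δ-respˡ {z}) (Δ-tagged u v) (MX.↭-sym p)
  ... | L , q , rs = L , (L , rs , MXX.↭-refl) , MXX.↭-sym q

  ∈c⁻ : ∀ {w} u v → (w , (u , v)) ∈R c X → w MX.↭ u ++ v
  ∈c⁻ {w} u v (L , (L' , rs , q) , q') = begin
    w                 ≋⟨ Δ-untag rs ⟩
    map untag L'      ↭⟨ PermutationProperties.map⁺ (X & X) X untag-cong (MXX.↭-trans q q') ⟩
    map untag (tagged u v) ≡⟨ untag-tagged u v ⟩
    u ++ v            ∎
    where open MX.PermutationReasoning

-- Run trees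

record Clause (P B A : Set) : Set where
  constructor clause
  field
    params : List P
    args   : List B
    result : A
open Clause

Holds : {P B A : Set} → (List P × List B → A → Set) → Clause P B A → Set
Holds R t = R (params t , args t) (result t)

module RunTreeInduction (X A : Obj) (f : Hom (! X ⊗ ! A) A) where
  open RunTrees X A f

  Closed : (List ∣ X ∣ → ∣ A ∣ → Set) → Set
  Closed P = ∀ {xs as ws a} → ((xs , as) , a) ∈R f → Pointwise P ws as → P (xs ++ concat ws) a

  module _ {P : List ∣ X ∣ → ∣ A ∣ → Set} (closed : Closed P) where
    runTree-ind : ∀ {a w} → RunTree a w → P w a
    forest-ind : ∀ {as ws} → Forest as ws → Pointwise P ws as
    runTree-ind (node _ _ _ _ ts fm) = closed fm (forest-ind ts)
    forest-ind [] = []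
    forest-ind (t ∷ ts) = runTree-ind t ∷ forest-ind ts

module Fixpoint (X A : Obj) (f : Hom (! X ⊗ ! A) A) (f-resp : Respects (! X ⊗ ! A) A f) where
  open RunTrees X A f
  open RunTreeInduction X A f public
  private
    module MX = Multiset X
    module MA = Multiset A

  Yf : List ∣ X ∣ → ∣ A ∣ → Set
  Yf = Hom._∋_ (Y X A f)

  Yf-↭ : ∀ {w w' a} → Yf w a → w MX.↭ w' → Yf w' a
  Yf-↭ (w₀ , t , p) q = w₀ , t , MX.↭-trans p q

  runTree-root : ∀ {a a' w} → RunTree a w → a MA.≈ a' → RunTree a' w
  runTree-root (node _ xs as ws ts fm) e = node _ xs as ws ts (f-resp _ _ _ _ (MX.↭-refl , MA.↭-refl) e fm)

  Yf-root : ∀ {w a a'} → Yf w a → a MA.≈ a' → Yf w a'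
  Yf-root (w₀ , t , p) e = w₀ , runTree-root t e , p

  private
    forest : ∀ {ws as} → Pointwise Yf ws as → ∃ λ ws' → Forest as ws' × Pointwise MX._↭_ ws' ws
    forest [] = [] , [] , []
    forest ((w₀ , t , p) ∷ ys) with forest ys
    ... | ws' , ts , ps = w₀ ∷ ws' , t ∷ ts , p ∷ ps

    unforest : ∀ {ws as} → Forest as ws → Pointwise Yf ws as
    unforest [] = []
    unforest (t ∷ ts) = (_ , t , MX.↭-refl) ∷ unforest ts

  ∈Y⁺ : ∀ {xs as ws w a} → ((xs , as) , a) ∈R f → Pointwise Yf ws as → xs ++ concat ws MX.↭ w → Yf w a
  ∈Y⁺ {xs} {as} fm ys p with forest ys
  ... | ws' , ts , ps = xs ++ concat ws' , node _ xs as ws' ts fm ,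
    MX.↭-trans (MX.++⁺ˡ xs (MX.concat-pointwise-↭ ps)) p

  ∈Y⁻ : ∀ {w a} → Yf w a → ∃ λ xs → ∃ λ as → ∃ λ ws →
    ((xs , as) , a) ∈R f × Pointwise Yf ws as × xs ++ concat ws MX.↭ w
  ∈Y⁻ (_ , node _ xs as ws ts fm , p) = xs , as , ws , fm , unforest ts , p

  Yf-respˡ : Yf Respectsˡ MX._↭_
  Yf-respˡ p y = Yf-↭ y p

  Y-closed : Closed Yf
  Y-closed fm ys = ∈Y⁺ fm ys MX.↭-refl

-- Plugging k : !X → B into the !B-argument of f, sharing the parameter

plug : (X A B : Obj) → Hom (! X ⊗ ! B) A → Hom (! X) B → Hom (! X) A
plug X A B f k = f ∘R (idR (! X) ⊗R (!R k ∘R dig X)) ∘R c X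

module Plug (X A B : Obj) (f : Hom (! X ⊗ ! B) A) (f-resp : Respects (! X ⊗ ! B) A f)
            (k : Hom (! X) B) (k-resp : Hom._∋_ k Respectsˡ Setoid._≈_ (! X)) where
  private
    module MX = Multiset X
    module MA = Multiset A
    module MB = Multiset B
  open Contraction X using (∈c⁺; ∈c⁻)

  Plugged : List ∣ X ∣ → ∣ A ∣ → Set
  Plugged w a = ∃ λ u → ∃ λ ws → ∃ λ bs →
    u ++ concat ws MX.↭ w × Pointwise (Hom._∋_ k) ws bs × ((u , bs) , a) ∈R f

  ∈plug⁺ : ∀ {w a} → Plugged w a → (w , a) ∈R plug X A B f k
  ∈plug⁺ (u , ws , bs , p , ks , fm) =
    (u , bs) , ((u , concat ws) , ∈c⁺ u (concat ws) (MX.↭-sym p) ,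
      (MX.↭-refl , (ws , (ws , Multiset.↭-refl (! X) , MX.↭-refl) , (bs , ks , MB.↭-refl)))) , fm

  ∈plug⁻ : ∀ {w a} → (w , a) ∈R plug X A B f k → Plugged w a
  ∈plug⁻ ((u , bs) , ((u₁ , v₁) , cm , (pu , (W , (ws , pW , pv) , (bs' , ks , pb)))) , fm)
    with Pointwise-↭ˡ (! X) B k-resp ks pW
  ... | bs'' , q , ks' = u , ws , bs'' ,
    MX.↭-trans (MX.++⁺ (MX.↭-sym pu) (MX.↭-sym pv)) (MX.↭-sym (∈c⁻ u₁ v₁ cm)) , ks' ,
    f-resp _ _ _ _ (MX.↭-refl , MB.↭-trans (MB.↭-sym pb) q) MA.≈-refl fm

  Plugged-↭ : ∀ {w w' a} → Plugged w a → w MX.↭ w' → Plugged w' a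
  Plugged-↭ (u , ws , bs , p , ks , fm) q = u , ws , bs , MX.↭-trans p q , ks , fm

  Plugged-root : ∀ {w a a'} → Plugged w a → a MA.≈ a' → Plugged w a'
  Plugged-root (u , ws , bs , p , ks , fm) e =
    u , ws , bs , p , ks , f-resp _ _ _ _ (MX.↭-refl , MB.↭-refl) e fm

  collect : ∀ {ws as} → Pointwise Plugged ws as → ∃ λ ts → ∃ λ wss →
    map result ts ≡ as × All (Holds (Hom._∋_ f)) ts × Pointwise (Pointwise (Hom._∋_ k)) wss (map args ts) ×
    concat (map params ts) ++ concat (concat wss) MX.↭ concat ws
  collect [] = [] , [] , refl , [] , [] , MX.↭-refl
  collect {w ∷ ws} {a ∷ as} ((u , vs , bs , p , ks , fm) ∷ ps) with collect ps
  ... | ts , wss , refl , fms , kss , q = clause u bs a ∷ ts , vs ∷ wss , refl , fm ∷ fms , ks ∷ kss ,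
    (begin
      (u ++ concat (map params ts)) ++ concat (vs ++ concat wss)
        ≡⟨ cong ((u ++ concat (map params ts)) ++_) (List.concat-++ vs (concat wss)) ⟨
      (u ++ concat (map params ts)) ++ concat vs ++ concat (concat wss)
        ↭⟨ MX.++-interchange u (concat (map params ts)) (concat vs) (concat (concat wss)) ⟩
      (u ++ concat vs) ++ concat (map params ts) ++ concat (concat wss)
        ↭⟨ MX.++⁺ p q ⟩
      w ++ concat ws ∎)
    where open MX.PermutationReasoning

fixpoint : (X A : Obj) (f : Hom (! X ⊗ ! A) A) → Respects (! X ⊗ ! A) A f →
  Y X A f ≐ plug X A A f (Y X A f)
fixpoint X A f f-resp =
  (λ _ _ y → let (xs , as , ws , fm , ys , p) = ∈Y⁻ y in ∈plug⁺ (xs , ws , as , p , ys , fm)) ,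
  (λ _ _ z → let (u , ws , bs , p , ys , fm) = ∈plug⁻ z in ∈Y⁺ fm ys p)
  where
  open Fixpoint X A f f-resp
  open Plug X A A f f-resp (Y X A f) Yf-respˡ

-- Naturality

module Naturality (X Z A : Obj) (g : Hom (! X) Z) (f : Hom (! Z ⊗ ! A) A)
                  (g-resp : Respects (! X) Z g) (f-resp : Respects (! Z ⊗ ! A) A f) where
  private
    module MX = Multiset X
    module MZ = Multiset Z
    module MA = Multiset A

  G : Hom (! X) (! Z)
  G = !R g ∘R dig X

  f' : Hom (! X ⊗ ! A) A
  f' = f ∘R (G ⊗R idR (! A))

  _∈g_ : List ∣ X ∣ → ∣ Z ∣ → Set
  _∈g_ = Hom._∋_ g

  Promoted : List ∣ X ∣ → List ∣ Z ∣ → Set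
  Promoted xs zs = ∃ λ ws → concat ws MX.↭ xs × ∃ λ zs' → Pointwise _∈g_ ws zs' × zs' MZ.↭ zs

  ∈G⁻ : ∀ {xs zs} → (xs , zs) ∈R G → Promoted xs zs
  ∈G⁻ (W , (ws , pW , pv) , (zs' , gs , pz))
    with Pointwise-↭ˡ (! X) Z (λ e r → g-resp _ _ _ _ e MZ.≈-refl r) gs pW
  ... | zs'' , q , gs' = ws , MX.↭-sym pv , zs'' , gs' , MZ.↭-trans (MZ.↭-sym q) pz

  ∈G⁺ : ∀ {xs zs} → Promoted xs zs → (xs , zs) ∈R G
  ∈G⁺ (ws , p , zs' , gs , pz) = ws , (ws , Multiset.↭-refl (! X) , MX.↭-sym p) , (zs' , gs , pz)

  Promoted-↭ : ∀ {xs xs' zs} → Promoted xs zs → xs MX.↭ xs' → Promoted xs' zs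
  Promoted-↭ (ws , p , r) q = ws , MX.↭-trans p q , r

  Promoted-++ : ∀ {xs₁ xs₂ zs₁ zs₂} → Promoted xs₁ zs₁ → Promoted xs₂ zs₂ →
    Promoted (xs₁ ++ xs₂) (zs₁ ++ zs₂)
  Promoted-++ (ws₁ , p₁ , zs₁ , gs₁ , q₁) (ws₂ , p₂ , zs₂ , gs₂ , q₂) =
    ws₁ ++ ws₂ , MX.↭-trans (MX.↭-reflexive (sym (List.concat-++ ws₁ ws₂))) (MX.++⁺ p₁ p₂) ,
    zs₁ ++ zs₂ , Pointwise.++⁺ gs₁ gs₂ , MZ.++⁺ q₁ q₂

  Promoted-concat : ∀ {xss zss} → Pointwise Promoted xss zss → Promoted (concat xss) (concat zss)
  Promoted-concat [] = [] , MX.↭-refl , [] , [] , MZ.↭-refl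
  Promoted-concat (p ∷ ps) = Promoted-++ p (Promoted-concat ps)

  f'-resp : Respects (! X ⊗ ! A) A f'
  f'-resp _ _ _ _ (p , q) e ((zs , as) , ((W , (ws , pW , pv) , gz) , pa) , fm) =
    (zs , as) , ((W , (ws , pW , MX.↭-trans (MX.↭-sym p) pv) , gz) , MA.↭-trans (MA.↭-sym q) pa) ,
    f-resp _ _ _ _ (MZ.↭-refl , MA.↭-refl) e fm

  module Y' = Fixpoint X A f' f'-resp
  module YZ = Fixpoint Z A f f-resp

  RunOverPromotion : List ∣ X ∣ → ∣ A ∣ → Set
  RunOverPromotion w a = ∃ λ zs → Promoted w zs × YZ.Yf zs a

  unzipRuns : ∀ {ws as} → Pointwise RunOverPromotion ws as →
    ∃ λ zss → Pointwise Promoted ws zss × Pointwise YZ.Yf zss as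
  unzipRuns [] = [] , [] , []
  unzipRuns ((zs , p , y) ∷ bs) with unzipRuns bs
  ... | zss , ps , ys = zs ∷ zss , p ∷ ps , y ∷ ys

  runOverPromotion-closed : Y'.Closed RunOverPromotion
  runOverPromotion-closed ((zs₀ , as') , (gm , pa) , fm) bs with unzipRuns bs
  ... | zss , ps , ys = zs₀ ++ concat zss , Promoted-++ (∈G⁻ gm) (Promoted-concat ps) ,
    YZ.Y-closed (f-resp _ _ _ _ (MZ.↭-refl , MA.↭-sym pa) MA.≈-refl fm) ys

  LiftsToRun : List ∣ Z ∣ → ∣ A ∣ → Set
  LiftsToRun zs a = ∀ {ws} → Pointwise _∈g_ ws zs → Y'.Yf (concat ws) a

  liftsToRun-closed : YZ.Closed LiftsToRun
  liftsToRun-closed {zs₀} {as} {zss} fm as' gs with Pointwise-++⁻ʳ zs₀ (concat zss) gs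
  ... | ws₀ , ws₁ , refl , gs₀ , gs₁ with Pointwise-concat⁻ʳ zss gs₁
  ... | wss , refl , gss =
    Y'.∈Y⁺ ((zs₀ , as) , (∈G⁺ (ws₀ , MX.↭-refl , zs₀ , gs₀ , MZ.↭-refl) , MA.↭-refl) , fm) (apply as' gss)
      (MX.↭-reflexive (trans (cong (concat ws₀ ++_) (List.concat-concat wss))
                             (List.concat-++ ws₀ (concat wss))))
    where
    apply : ∀ {zss as wss} → Pointwise LiftsToRun zss as → Pointwise (Pointwise _∈g_) wss zss →
      Pointwise Y'.Yf (map concat wss) as
    apply [] [] = []
    apply (a ∷ as) (g ∷ gs) = a g ∷ apply as gs

  naturality : Y X A f' ≐ Y Z A f ∘R G
  naturality =
    (λ _ _ → λ { (_ , t , p) → let (zs , pr , y) = Y'.runTree-ind runOverPromotion-closed t in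
                                 zs , ∈G⁺ (Promoted-↭ pr p) , y }) ,
    (λ _ _ → λ { (_ , gm , (_ , t , pz)) → above (∈G⁻ gm) t pz })
    where
    above : ∀ {w zs zs' a} → Promoted w zs → RunTrees.RunTree Z A f a zs' → zs' MZ.↭ zs → Y'.Yf w a
    above (ws , pv , zs'' , gs , pz') t pz
      with Pointwise-↭ʳ (! X) Z (λ e r → g-resp _ _ _ _ MX.↭-refl e r) gs (MZ.↭-trans pz' (MZ.↭-sym pz))
    ... | ws' , q , gs' =
      Y'.Yf-↭ (YZ.runTree-ind liftsToRun-closed t gs') (MX.↭-trans (MX.concat-↭ (Multiset.↭-sym (! X) q)) pv)

-- Dinaturality

module Star (X A B : Obj) (f : Hom (! X ⊗ ! B) A) (g : Hom (! X ⊗ ! A) B)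
            (f-resp : Respects (! X ⊗ ! B) A f) (g-resp : Respects (! X ⊗ ! A) B g) where
  private
    module MX = Multiset X
    module MA = Multiset A
    module MB = Multiset B
    module MXA = Multiset (X & A)
  open Tagged X A
  open Contraction X using (∈c⁺; ∈c⁻)

  -- an f-clause each of whose arguments is the result of a g-clause
  StarClause : List ∣ X ∣ → List ∣ A ∣ → ∣ A ∣ → Set
  StarClause xs as a = ∃ λ u → ∃ λ ts →
    u ++ concat (map params ts) MX.↭ xs × concat (map args ts) MA.↭ as ×
    All (Holds (Hom._∋_ g)) ts × ((u , map result ts) , a) ∈R f

  g∘m⁻¹ : Hom (! (X & A)) B
  g∘m⁻¹ = g ∘R m⁻¹ X A

  taggedClause : Clause (∣ X ∣) (∣ A ∣) (∣ B ∣) → List (∣ X ∣ ⊎ ∣ A ∣)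
  taggedClause t = tagged (params t) (args t)

  concat-taggedClause : ∀ ts →
    concat (map taggedClause ts) MXA.↭ tagged (concat (map params ts)) (concat (map args ts))
  concat-taggedClause [] = MXA.↭-refl
  concat-taggedClause (t ∷ ts) =
    MXA.↭-trans (MXA.++⁺ˡ (taggedClause t) (concat-taggedClause ts)) (tagged-++ (params t) (args t) _ _)

  clauses⇒g∘m⁻¹ : ∀ ts → All (Holds (Hom._∋_ g)) ts →
    Pointwise (Hom._∋_ g∘m⁻¹) (map taggedClause ts) (map result ts)
  clauses⇒g∘m⁻¹ [] [] = []
  clauses⇒g∘m⁻¹ (t ∷ ts) (gm ∷ gms) = ((params t , args t) , MXA.↭-refl , gm) ∷ clauses⇒g∘m⁻¹ ts gms

  g∘m⁻¹⇒clauses : ∀ {Ls bs} → Pointwise (Hom._∋_ g∘m⁻¹) Ls bs → ∃ λ ts → map result ts ≡ bs ×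
    All (Holds (Hom._∋_ g)) ts × concat Ls MXA.↭ concat (map taggedClause ts)
  g∘m⁻¹⇒clauses [] = [] , refl , [] , MXA.↭-refl
  g∘m⁻¹⇒clauses {_ ∷ _} {b ∷ _} (((xs , as) , p , gm) ∷ rs) with g∘m⁻¹⇒clauses rs
  ... | ts , refl , gms , q = clause xs as b ∷ ts , refl , gm ∷ gms , MXA.++⁺ p q

  g∘m⁻¹-resp : Hom._∋_ g∘m⁻¹ Respectsˡ Setoid._≈_ (! (X & A))
  g∘m⁻¹-resp e (xa , p , gm) = xa , MXA.↭-trans (MXA.↭-sym e) p , gm

  ∈star⁺ : ∀ {xs as a} → StarClause xs as a → ((xs , as) , a) ∈R star X A B f g
  ∈star⁺ {xs} {as} (u , ts , px , pa , gms , fm) =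
    (u , map result ts) ,
    ((u , map taggedClause ts) ,
     ((u , tagged v as) ,
      ((u , (v , as)) ,
       (((u , v) , as) , (∈c⁺ u v (MX.↭-sym px) , MA.↭-refl) , (MX.↭-refl , MX.↭-refl , MA.↭-refl)) ,
       (MX.↭-refl , MXA.↭-refl)) ,
      (MX.↭-refl , (map taggedClause ts , Multiset.↭-refl (! (X & A)) ,
        MXA.↭-trans (tagged⁺ MX.↭-refl (MA.↭-sym pa)) (MXA.↭-sym (concat-taggedClause ts))))) ,
     (MX.↭-refl , (map result ts , clauses⇒g∘m⁻¹ ts gms , MB.↭-refl))) ,
    fm
    where v = concat (map params ts)

  ∈star⁻ : ∀ {xs as a} → ((xs , as) , a) ∈R star X A B f g → StarClause xs as a
  ∈star⁻ ((u₄ , bs) ,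
          ((_ , LL) ,
           ((_ , L) ,
            ((_ , _) ,
             (((u , v) , _) , (cm , pa) , (e₁ , e₂ , e₃)) ,
             (p₃ , pm)) ,
            (p₂ , (Ls , pLL , pdig))) ,
           (p₁ , (_ , gs , pbs))) ,
          fm)
    with Pointwise-↭ˡ (! (X & A)) B g∘m⁻¹-resp gs pLL
  ... | bs' , pbs' , gs' with g∘m⁻¹⇒clauses gs'
  ... | ts , refl , gms , pc
    with tagged-cancel (MXA.↭-trans (MXA.↭-sym pm)
                         (MXA.↭-trans pdig (MXA.↭-trans pc (concat-taggedClause ts))))
  ... | pv , pas =
    u₄ , ts ,
    MX.↭-trans (MX.++⁺ (MX.↭-sym (MX.↭-trans e₁ (MX.↭-trans p₃ (MX.↭-trans p₂ p₁))))
                       (MX.↭-sym (MX.↭-trans e₂ pv)))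
               (MX.↭-sym (∈c⁻ u v cm)) ,
    MA.↭-sym (MA.↭-trans pa (MA.↭-trans e₃ pas)) ,
    gms ,
    f-resp _ _ _ _ (MX.↭-refl , MB.↭-trans (MB.↭-sym pbs) pbs') MA.≈-refl fm

  star-resp : Respects (! X ⊗ ! A) A (star X A B f g)
  star-resp _ _ _ _ (p , q) e sm with ∈star⁻ sm
  ... | u , ts , px , pa , gms , fm =
    ∈star⁺ (u , ts , MX.↭-trans px p , MA.↭-trans pa q , gms , f-resp _ _ _ _ (MX.↭-refl , MB.↭-refl) e fm)

module Dinaturality (X A B : Obj) (f : Hom (! X ⊗ ! B) A) (g : Hom (! X ⊗ ! A) B)
                    (f-resp : Respects (! X ⊗ ! B) A f) (g-resp : Respects (! X ⊗ ! A) B g) where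
  private
    module MX = Multiset X
    module MA = Multiset A
    module MB = Multiset B
  open Star X A B f g f-resp g-resp public
  module Y⋆ = Fixpoint X A (star X A B f g) star-resp
  module Y⋆' = Fixpoint X B (star X B A g f) (Star.star-resp X B A g f g-resp f-resp)
  open Plug X A B f f-resp (Y X B (star X B A g f)) Y⋆'.Yf-respˡ public

  gClause⇒Y⋆' : ∀ {t wss} → Holds (Hom._∋_ g) t → Pointwise Plugged wss (args t) →
    Y⋆'.Yf (params t ++ concat wss) (result t)
  gClause⇒Y⋆' {clause xs _ _} gm ps with collect ps
  ... | ts , wss' , refl , fms , kss , p =
    Y⋆'.∈Y⁺ (Star.∈star⁺ X B A g f g-resp f-resp (xs , ts , MX.↭-refl , MB.↭-refl , fms , gm))
      (Pointwise.concat⁺ kss)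
      (MX.↭-trans (MX.++-assoc xs (concat (map params ts)) (concat (concat wss'))) (MX.++⁺ˡ xs p))

  gClauses⇒Y⋆' : ∀ {ts wss} → All (Holds (Hom._∋_ g)) ts → Pointwise (Pointwise Plugged) wss (map args ts) →
    ∃ λ ws → Pointwise Y⋆'.Yf ws (map result ts) ×
             concat ws MX.↭ concat (map params ts) ++ concat (concat wss)
  gClauses⇒Y⋆' {[]} {[]} [] [] = [] , [] , MX.↭-refl
  gClauses⇒Y⋆' {t ∷ ts} {ws₀ ∷ wss} (gm ∷ gms) (ps ∷ pss) with gClauses⇒Y⋆' gms pss
  ... | ws , ys , p = (params t ++ concat ws₀) ∷ ws , gClause⇒Y⋆' gm ps ∷ ys , (begin
    (params t ++ concat ws₀) ++ concat ws
      ↭⟨ MX.++⁺ˡ (params t ++ concat ws₀) p ⟩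
    (params t ++ concat ws₀) ++ concat (map params ts) ++ concat (concat wss)
      ↭⟨ MX.++-interchange (params t) (concat ws₀) (concat (map params ts)) (concat (concat wss)) ⟩
    (params t ++ concat (map params ts)) ++ concat ws₀ ++ concat (concat wss)
      ≡⟨ cong ((params t ++ concat (map params ts)) ++_) (List.concat-++ ws₀ (concat wss)) ⟩
    (params t ++ concat (map params ts)) ++ concat (ws₀ ++ concat wss) ∎)
    where open MX.PermutationReasoning

  plugged-closed : Y⋆.Closed Plugged
  plugged-closed {xs} {ws = ws} sm ps with ∈star⁻ sm
  ... | u , ts , px , pa , gms , fm
    with Pointwise-↭ʳ (! X) A (λ e p → Plugged-root p e) ps (MA.↭-sym pa)
  ... | ws' , q , ps' with Pointwise-concat⁻ʳ (map args ts) ps'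
  ... | wss , refl , pss with gClauses⇒Y⋆' gms pss
  ... | vs , ys , pv = u , vs , map result ts , (begin
    u ++ concat vs
      ↭⟨ MX.++⁺ˡ u pv ⟩
    u ++ concat (map params ts) ++ concat (concat wss)
      ↭⟨ MX.++-assoc u (concat (map params ts)) (concat (concat wss)) ⟨
    (u ++ concat (map params ts)) ++ concat (concat wss)
      ↭⟨ MX.++⁺ px (MX.concat-↭ (Multiset.↭-sym (! X) q)) ⟩
    xs ++ concat ws ∎) , ys , fm
    where open MX.PermutationReasoning

  Y⋆⇒Plugged : ∀ {w a} → Y⋆.Yf w a → Plugged w a
  Y⋆⇒Plugged (_ , t , p) = Plugged-↭ (Y⋆.runTree-ind plugged-closed t) p

dinaturality : (X A B : Obj) (f : Hom (! X ⊗ ! B) A) (g : Hom (! X ⊗ ! A) B) →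
  Respects (! X ⊗ ! B) A f → Respects (! X ⊗ ! A) B g →
  Y X A (star X A B f g) ≐ plug X A B f (Y X B (star X B A g f))
dinaturality X A B f g f-resp g-resp =
  (λ _ _ y → ∈plug⁺ (Y⋆⇒Plugged y)) , (λ _ _ z → plugged⇒Y⋆ (∈plug⁻ z))
  where
  open Dinaturality X A B f g f-resp g-resp
  module Swapped = Dinaturality X B A g f g-resp f-resp

  plugged⇒Y⋆ : ∀ {w a} → Plugged w a → Y⋆.Yf w a
  plugged⇒Y⋆ {w} (u , ws , bs , p , ys , fm) with Swapped.collect (Pointwise.map Swapped.Y⋆⇒Plugged ys)
  ... | ts , wss , refl , gms , kss , q =
    Y⋆.∈Y⁺ (∈star⁺ (u , ts , MX.↭-refl , MA.↭-refl , gms , fm)) (Pointwise.concat⁺ kss) (begin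
      (u ++ concat (map params ts)) ++ concat (concat wss) ↭⟨ MX.++-assoc u _ _ ⟩
      u ++ concat (map params ts) ++ concat (concat wss)   ↭⟨ MX.++⁺ˡ u q ⟩
      u ++ concat ws                                       ↭⟨ p ⟩
      w                                                    ∎)
    where
    module MX = Multiset X
    module MA = Multiset A
    open MX.PermutationReasoning

-- The diagonal property

module Diagonal (X A : Obj) (f : Hom ((! X ⊗ ! A) ⊗ ! A) A)
                (f-resp : Respects ((! X ⊗ ! A) ⊗ ! A) A f) where
  private
    module MX = Multiset X
    module MA = Multiset A
    module MXA = Multiset (X & A)
    module M!X = Multiset (! X)
  open Tagged X A

  fInner : Hom (! (X & A) ⊗ ! A) A
  fInner = f ∘R (m⁻¹ X A ⊗R idR (! A))

  fInner-resp : Respects (! (X & A) ⊗ ! A) A fInner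
  fInner-resp _ _ _ _ (p , q) e (((xs , as₁) , as₂) , (pm , pa) , fm) =
    ((xs , as₁) , as₂) , (MXA.↭-trans (MXA.↭-sym p) pm , MA.↭-trans (MA.↭-sym q) pa) ,
    f-resp _ _ _ _ ((MX.↭-refl , MA.↭-refl) , MA.↭-refl) e fm

  module YInner = Fixpoint (X & A) A fInner fInner-resp

  fNested : Hom (! X ⊗ ! A) A
  fNested = Y (X & A) A fInner ∘R m X A

  fNested-resp : Respects (! X ⊗ ! A) A fNested
  fNested-resp _ _ _ _ (p , q) e (L , pm , y) = L , MXA.↭-trans pm (tagged⁺ p q) , YInner.Yf-root y e

  module YNested = Fixpoint X A fNested fNested-resp

  fDiag : Hom (! X ⊗ ! A) A
  fDiag = f ∘R α⁻¹ (! X) (! A) (! A) ∘R (idR (! X) ⊗R c A)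

  DiagClause : List ∣ X ∣ → List ∣ A ∣ → ∣ A ∣ → Set
  DiagClause xs as a = ∃ λ as₁ → ∃ λ as₂ → as₁ ++ as₂ MA.↭ as × (((xs , as₁) , as₂) , a) ∈R f

  ∈fDiag⁺ : ∀ {xs as a} → DiagClause xs as a → ((xs , as) , a) ∈R fDiag
  ∈fDiag⁺ {xs} (as₁ , as₂ , p , fm) =
    ((xs , as₁) , as₂) ,
    ((xs , (as₁ , as₂)) , (MX.↭-refl , Contraction.∈c⁺ A as₁ as₂ (MA.↭-sym p)) ,
     (MX.↭-refl , MA.↭-refl , MA.↭-refl)) ,
    fm

  ∈fDiag⁻ : ∀ {xs as a} → ((xs , as) , a) ∈R fDiag → DiagClause xs as a
  ∈fDiag⁻ (((_ , as₁') , as₂') , ((_ , (as₁ , as₂)) , (px , cm) , (e₁ , e₂ , e₃)) , fm) =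
    as₁' , as₂' , MA.↭-trans (MA.++⁺ e₂ e₃) (MA.↭-sym (Contraction.∈c⁻ A as₁ as₂ cm)) ,
    f-resp _ _ _ _ ((MX.↭-trans e₁ (MX.↭-sym px) , MA.↭-refl) , MA.↭-refl) MA.≈-refl fm

  fDiag-resp : Respects (! X ⊗ ! A) A fDiag
  fDiag-resp _ _ _ _ (p , q) e dm with ∈fDiag⁻ dm
  ... | as₁ , as₂ , pa , fm =
    ∈fDiag⁺ (as₁ , as₂ , MA.↭-trans pa q , f-resp _ _ _ _ ((p , MA.↭-refl) , MA.↭-refl) e fm)

  module YDiag = Fixpoint X A fDiag fDiag-resp

  -- a leaf of an inner tree: an X-leaf stands for itself, an A-leaf for a tree in P
  Expand : (List ∣ X ∣ → ∣ A ∣ → Set) → ∣ X & A ∣ → List ∣ X ∣ → Set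
  Expand P (inj₁ x) w = w MX.↭ [ x ]
  Expand P (inj₂ a) w = P w a

  Expand-respˡ : ∀ {P} → (∀ {w a a'} → P w a → a MA.≈ a' → P w a') →
    Expand P Respectsˡ Setoid._≈_ (X & A)
  Expand-respˡ P-root (inj₁ e) p = MX.↭-trans p (MX.prep e MX.↭-refl)
  Expand-respˡ P-root (inj₂ e) p = P-root p e

  Expand-inj₁⁺ : ∀ {P} xs → Pointwise (Expand P) (map inj₁ xs) (map [_] xs)
  Expand-inj₁⁺ [] = []
  Expand-inj₁⁺ (x ∷ xs) = MX.↭-refl ∷ Expand-inj₁⁺ xs

  Expand-inj₁⁻ : ∀ {P xs ws} → Pointwise (Expand P) (map inj₁ xs) ws → concat ws MX.↭ xs
  Expand-inj₁⁻ {xs = []} [] = MX.↭-refl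
  Expand-inj₁⁻ {xs = x ∷ xs} (p ∷ ps) = MX.++⁺ p (Expand-inj₁⁻ ps)

  Expand-inj₂⁺ : ∀ {P as ws} → Pointwise P ws as → Pointwise (Expand P) (map inj₂ as) ws
  Expand-inj₂⁺ [] = []
  Expand-inj₂⁺ (p ∷ ps) = p ∷ Expand-inj₂⁺ ps

  Expand-inj₂⁻ : ∀ {P as ws} → Pointwise (Expand P) (map inj₂ as) ws → Pointwise P ws as
  Expand-inj₂⁻ {as = []} [] = []
  Expand-inj₂⁻ {as = a ∷ as} (p ∷ ps) = p ∷ Expand-inj₂⁻ ps

  Grafts : List ∣ X & A ∣ → ∣ A ∣ → Set
  Grafts L a = ∀ {ws} → Pointwise (Expand YDiag.Yf) L ws → YDiag.Yf (concat ws) a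

  grafts-closed : YInner.Closed Grafts
  grafts-closed {Ls} {ws = wsT} (((xs , as₁) , as₂) , (pm , pa) , fm) gs {ws} es
    with Pointwise-++⁻ˡ Ls (concat wsT) es
  ... | ws₁ , ws₂ , refl , es₁ , es₂ with Pointwise-concat⁻ˡ wsT es₂
  ... | wss , refl , ess with Pointwise-↭ˡ (X & A) (! X) (Expand-respˡ YDiag.Yf-root) es₁ pm
  ... | ws₁' , r , es₁' with Pointwise-++⁻ˡ (map inj₁ xs) (map inj₂ as₁) es₁'
  ... | wa , wb , refl , ea , eb =
    YDiag.∈Y⁺ (∈fDiag⁺ (as₁ , as₂ , MA.++⁺ˡ as₁ (MA.↭-sym pa) , fm))
      (Pointwise.++⁺ (Expand-inj₂⁻ eb) (graft gs ess))
      (begin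
        xs ++ concat (wb ++ map concat wss)
          ≡⟨ cong (xs ++_) (List.concat-++ wb (map concat wss)) ⟨
        xs ++ concat wb ++ concat (map concat wss)
          ↭⟨ MX.++-assoc xs (concat wb) _ ⟨
        (xs ++ concat wb) ++ concat (map concat wss)
          ↭⟨ MX.++⁺ (MX.++⁺ʳ (concat wb) (MX.↭-sym (Expand-inj₁⁻ ea))) (MX.↭-reflexive (List.concat-concat wss)) ⟩
        (concat wa ++ concat wb) ++ concat (concat wss)
          ≡⟨ cong (_++ concat (concat wss)) (List.concat-++ wa wb) ⟩
        concat (wa ++ wb) ++ concat (concat wss)
          ↭⟨ MX.++⁺ʳ (concat (concat wss)) (MX.concat-↭ (M!X.↭-sym r)) ⟩
        concat ws₁ ++ concat (concat wss)
          ≡⟨ List.concat-++ ws₁ (concat wss) ⟩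
        concat (ws₁ ++ concat wss) ∎)
    where
    open MX.PermutationReasoning
    graft : ∀ {wsT as wss} → Pointwise Grafts wsT as → Pointwise (Pointwise (Expand YDiag.Yf)) wsT wss →
      Pointwise YDiag.Yf (map concat wss) as
    graft [] [] = []
    graft (g ∷ gs) (es ∷ ess) = g es ∷ graft gs ess

  nested-closed : YNested.Closed YDiag.Yf
  nested-closed {xs} {ws = ws} (L , pm , (_ , t , pL)) ys
    with Pointwise-↭ˡ (X & A) (! X) (Expand-respˡ YDiag.Yf-root)
           (Pointwise.++⁺ (Expand-inj₁⁺ xs) (Expand-inj₂⁺ ys)) (MXA.↭-sym (MXA.↭-trans pL pm))
  ... | ws' , r , es = YDiag.Yf-↭ (YInner.runTree-ind grafts-closed t es) (begin
    concat ws'                          ↭⟨ MX.concat-↭ (M!X.↭-sym r) ⟩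
    concat (map [_] xs ++ ws)           ≡⟨ List.concat-++ (map [_] xs) ws ⟨
    concat (map [_] xs) ++ concat ws    ≡⟨ cong (_++ concat ws) (List.concat-map-[_] xs) ⟩
    xs ++ concat ws                     ∎)
    where open MX.PermutationReasoning

  Grafted : List ∣ X ∣ → ∣ A ∣ → Set
  Grafted w a = ∃ λ L → ∃ λ ws → YInner.Yf L a × Pointwise (Expand YNested.Yf) L ws × concat ws MX.↭ w

  Grafted-root : ∀ {w a a'} → Grafted w a → a MA.≈ a' → Grafted w a'
  Grafted-root (L , ws , y , es , p) e = L , ws , YInner.Yf-root y e , es , p

  grafted⇒nested : ∀ {w a} → Grafted w a → YNested.Yf w a
  grafted⇒nested {w} (L , ws , y , es , p)
    with Pointwise-↭ˡ (X & A) (! X) (Expand-respˡ YNested.Yf-root) es (↭-tagged L)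
  ... | ws' , r , es' with Pointwise-++⁻ˡ (map inj₁ (lefts L)) (map inj₂ (rights L)) es'
  ... | wa , wb , refl , ea , eb = YNested.∈Y⁺ (L , ↭-tagged L , y) (Expand-inj₂⁻ eb) (begin
    lefts L ++ concat wb       ↭⟨ MX.++⁺ʳ (concat wb) (MX.↭-sym (Expand-inj₁⁻ ea)) ⟩
    concat wa ++ concat wb     ≡⟨ List.concat-++ wa wb ⟩
    concat (wa ++ wb)          ↭⟨ MX.concat-↭ (M!X.↭-sym r) ⟩
    concat ws                  ↭⟨ p ⟩
    w                          ∎)
    where open MX.PermutationReasoning

  unzipGrafted : ∀ {ws as} → Pointwise Grafted ws as → ∃ λ Ls → ∃ λ wss →
    Pointwise YInner.Yf Ls as × Pointwise (Pointwise (Expand YNested.Yf)) Ls wss ×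
    Pointwise MX._↭_ (map concat wss) ws
  unzipGrafted [] = [] , [] , [] , [] , []
  unzipGrafted ((L , ws , y , es , p) ∷ gs) with unzipGrafted gs
  ... | Ls , wss , ys , ess , ps = L ∷ Ls , ws ∷ wss , y ∷ ys , es ∷ ess , p ∷ ps

  grafted-closed : YDiag.Closed Grafted
  grafted-closed {xs} {ws = ws} dm gs with ∈fDiag⁻ dm
  ... | as₁ , as₂ , pa , fm with Pointwise-↭ʳ (! X) A (λ e g → Grafted-root g e) gs (MA.↭-sym pa)
  ... | ws' , q , gs' with Pointwise-++⁻ʳ as₁ as₂ gs'
  ... | ws₁ , ws₂ , refl , gs₁ , gs₂ with unzipGrafted gs₂
  ... | Ls , wss , ys , ess , ps =
    tagged xs as₁ ++ concat Ls , (map [_] xs ++ ws₁) ++ concat wss ,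
    YInner.Y-closed (((xs , as₁) , as₂) , (MXA.↭-refl , MA.↭-refl) , fm) ys ,
    Pointwise.++⁺ (Pointwise.++⁺ (Expand-inj₁⁺ xs) (Expand-inj₂⁺ (Pointwise.map grafted⇒nested gs₁)))
                  (Pointwise.concat⁺ ess) ,
    (begin
      concat ((map [_] xs ++ ws₁) ++ concat wss)
        ≡⟨ List.concat-++ (map [_] xs ++ ws₁) (concat wss) ⟨
      concat (map [_] xs ++ ws₁) ++ concat (concat wss)
        ≡⟨ cong (_++ concat (concat wss)) (List.concat-++ (map [_] xs) ws₁) ⟨
      (concat (map [_] xs) ++ concat ws₁) ++ concat (concat wss)
        ≡⟨ cong (λ ys → (ys ++ concat ws₁) ++ concat (concat wss)) (List.concat-map-[_] xs) ⟩
      (xs ++ concat ws₁) ++ concat (concat wss)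
        ≡⟨ cong ((xs ++ concat ws₁) ++_) (List.concat-concat wss) ⟨
      (xs ++ concat ws₁) ++ concat (map concat wss)
        ↭⟨ MX.++⁺ˡ (xs ++ concat ws₁) (MX.concat-pointwise-↭ ps) ⟩
      (xs ++ concat ws₁) ++ concat ws₂
        ↭⟨ MX.++-assoc xs (concat ws₁) (concat ws₂) ⟩
      xs ++ concat ws₁ ++ concat ws₂
        ≡⟨ cong (xs ++_) (List.concat-++ ws₁ ws₂) ⟩
      xs ++ concat (ws₁ ++ ws₂)
        ↭⟨ MX.++⁺ˡ xs (MX.concat-↭ (M!X.↭-sym q)) ⟩
      xs ++ concat ws ∎)
    where open MX.PermutationReasoning

  diagonal : Y X A fNested ≐ Y X A fDiag
  diagonal =
    (λ _ _ → λ { (_ , t , p) → YDiag.Yf-↭ (YNested.runTree-ind nested-closed t) p }) ,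
    (λ _ _ → λ { (_ , t , p) → YNested.Yf-↭ (grafted⇒nested (YDiag.runTree-ind grafted-closed t)) p })

mainTheorem1 : IsConway Y
mainTheorem1 = record
  { naturality   = λ X Z A _ _ _ → Naturality.naturality X Z A
  ; fixpoint     = λ X A _ _ → fixpoint X A
  ; dinaturality = λ X A B _ _ _ → dinaturality X A B
  ; diagonal     = λ X A _ _ → Diagonal.diagonal X A
  }
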